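{- If $\Gamma\vdash_\omega M:A$ is derivable in $\Lambda_{\cap\omega}$, then $\Gamma\vdash_{s\omega} M:A$ is derivable in $\Lambda_{\cap\omega}^s$.
   Context: $\lambda$-terms: $M::=x\mid MM\mid\lambda x.M$ modulo $\alpha$-conversion; $M[x:=N]$ capture-avoiding substitution. Types: $A::=\varphi\mid\omega\mid A\to A\mid A\cap A$. A typing context is a finite set of pairs $x:A$ ($\Gamma,x:A$ denotes $\Gamma\cup\{x:A\}$; $x\notin\Gamma$ means no $x:B$ lies in $\Gamma$); in $\Lambda_{\cap\omega}$ its variables are pairwise distinct, in $\Lambda_{\cap\omega}^s$ a variable may occur with several types. $\Lambda_{\cap\omega}$: (Ax) $\Gamma,x:A\vdash_\omega x:A$; ($\to$I) from $\Gamma,x:A\vdash_\omega M:B$, $x\notin\Gamma$, infer $\Gamma\vdash_\omega\lambda x.M:A\to B$; ($\to$E) from $\Gamma\vdash_\omega M:A\to B$ and $\Gamma\vdash_\omega N:A$ infer $\Gamma\vdash_\omega MN:B$; ($\cap$I) from $\Gamma\vdash_\omega M:A$, $\Gamma\vdash_\omega M:B$ infer $\Gamma\vdash_\omega M:A\cap B$; ($\cap$E) from $\Gamma\vdash_\omega M:A\cap B$ infer $\Gamma\vdash_\omega M:A$ and $\Gamma\vdash_\omega M:B$; $(\omega)$ $\Gamma\vdash_\omega M:\omega$. $\Lambda_{\cap\omega}^s$ ($n\ge0$): (Ax) $\Gamma,x:A\vdash_{s\omega} x:A$; $(\mathsf{Beta})^s$ from $\Gamma\vdash_{s\omega} M[x:=N]N_1\dots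 N_n:A$ and $\Gamma\vdash_{s\omega} N:B$ infer $\Gamma\vdash_{s\omega}(\lambda x.M)NN_1\dots N_n:A$; $(\mathsf{L}\to)$ from $\Gamma\vdash_{s\omega} N:A_1$ and $\Gamma,y:A_2\vdash_{s\omega} yN_1\dots N_n:B$, with $y\notin FV(N_1)\cup\dots\cup FV(N_n)$, $y\notin\Gamma$, infer $\Gamma,x:A_1\to A_2\vdash_{s\omega} xNN_1\dots N_n:B$; $(\mathsf{R}\to)$ from $\Gamma,x:A\vdash_{s\omega} M:B$, $x\notin\Gamma$, infer $\Gamma\vdash_{s\omega}\lambda x.M:A\to B$; $(\mathsf{L}\cap)$ from $\Gamma,x:A_1,x:A_2\vdash_{s\omega} xN_1\dots N_n:B$ infer $\Gamma,x:A_1\cap A_2\vdash_{s\omega} xN_1\dots N_n:B$; $(\mathsf{R}\cap)$ from $\Gamma\vdash_{s\omega} M:A$ and $\Gamma\vdash_{s\omega} M:B$ infer $\Gamma\vdash_{s\omega} M:A\cap B$; $(\omega)$ $\Gamma\vdash_{s\omega} M:\omega$. -}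

module Defs where

open import Data.Nat using (ℕ; zero; suc)
open import Data.Product using (_×_; _,_; proj₁; map₁)
open import Data.List using (List; []; _∷_; map; foldl)
open import Data.List.Membership.Propositional using (_∈_; _∉_)
open import Data.List.Relation.Unary.All using (All)
open import Data.List.Relation.Unary.Unique.Propositional using (Unique)
open import Data.List.Relation.Binary.BagAndSetEquality using (_∼[_]_; set)
open import Relation.Nullary using (¬_)

-- λ-terms modulo α-conversion: de Bruijn indices (free variables are
-- indices too; λ binds index 0).

data Term : Set where
  var : ℕ → Term
  _·_ : Term → Term → Term
  ƛ_  : Term → Term

infixl 7 _·_
infix  5 ƛ_

_·*_ : Term → List Term → Term
M ·* Ns = foldl _·_ M Ns

infixl 6 _·*_

ext : (ℕ → ℕ) → ℕ → ℕ
ext ρ zero    = zero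
ext ρ (suc n) = suc (ρ n)

rename : (ℕ → ℕ) → Term → Term
rename ρ (var x) = var (ρ x)
rename ρ (M · N) = rename ρ M · rename ρ N
rename ρ (ƛ M)   = ƛ rename (ext ρ) M

exts : (ℕ → Term) → ℕ → Term
exts σ zero    = var zero
exts σ (suc n) = rename suc (σ n)

subst : (ℕ → Term) → Term → Term
subst σ (var x) = σ x
subst σ (M · N) = subst σ M · subst σ N
subst σ (ƛ M)   = ƛ subst (exts σ) M

single : Term → ℕ → Term
single N zero    = N
single N (suc n) = var n

-- M[x:=N] where M is the body of λx.M (x = index 0)
_[_]₀ : Term → Term → Term
M [ N ]₀ = subst (single N) M

data _FreeIn_ : ℕ → Term → Set where
  fv-var : ∀ {x} → x FreeIn var x
  fv-·ˡ  : ∀ {x M N} → x FreeIn M → x FreeIn (M · N)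
  fv-·ʳ  : ∀ {x M N} → x FreeIn N → x FreeIn (M · N)
  fv-ƛ   : ∀ {x M} → suc x FreeIn M → x FreeIn (ƛ M)

data Type : Set where
  φ   : ℕ → Type
  ω   : Type
  _⇒_ : Type → Type → Type
  _∩_ : Type → Type → Type

infixr 6 _⇒_
infixl 7 _∩_

-- Contexts: finite sets of pairs x:A, represented by lists up to set
-- equality (only membership matters).

Ctx : Set
Ctx = List (ℕ × Type)

dom : Ctx → List ℕ
dom Γ = map proj₁ Γ

-- pairwise distinct variables (contexts of Λ∩ω)
Valid : Ctx → Set
Valid Γ = Unique (dom Γ)

↑ : Ctx → Ctx
↑ Γ = map (map₁ suc) Γ

infix 3 _⊢ω_∶_
data _⊢ω_∶_ : Ctx → Term → Type → Set where
  Ax  : ∀ {Γ x A} → (x , A) ∈ Γ → Γ ⊢ω var x ∶ A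
  →I  : ∀ {Γ M A B} → ((zero , A) ∷ ↑ Γ) ⊢ω M ∶ B → Γ ⊢ω ƛ M ∶ A ⇒ B
  →E  : ∀ {Γ M N A B} → Γ ⊢ω M ∶ A ⇒ B → Γ ⊢ω N ∶ A → Γ ⊢ω M · N ∶ B
  ∩I  : ∀ {Γ M A B} → Γ ⊢ω M ∶ A → Γ ⊢ω M ∶ B → Γ ⊢ω M ∶ A ∩ B
  ∩E₁ : ∀ {Γ M A B} → Γ ⊢ω M ∶ A ∩ B → Γ ⊢ω M ∶ A
  ∩E₂ : ∀ {Γ M A B} → Γ ⊢ω M ∶ A ∩ B → Γ ⊢ω M ∶ B
  ωI  : ∀ {Γ M} → Γ ⊢ω M ∶ ω

-- Λ∩ω^s   (Δ ∼[ set ] (x , A) ∷ Γ  expresses  Δ = Γ, x:A = Γ ∪ {x:A})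

infix 3 _⊢s_∶_
data _⊢s_∶_ : Ctx → Term → Type → Set where
  Ax   : ∀ {Γ x A} → (x , A) ∈ Γ → Γ ⊢s var x ∶ A
  Beta : ∀ {Γ M N Ns A B} →
         Γ ⊢s (M [ N ]₀) ·* Ns ∶ A → Γ ⊢s N ∶ B →
         Γ ⊢s (ƛ M) · N ·* Ns ∶ A
  L→   : ∀ {Δ Γ x y N Ns A₁ A₂ B} →
         Δ ∼[ set ] ((x , A₁ ⇒ A₂) ∷ Γ) →
         Γ ⊢s N ∶ A₁ →
         ((y , A₂) ∷ Γ) ⊢s var y ·* Ns ∶ B →
         All (λ P → ¬ (y FreeIn P)) Ns →
         y ∉ dom Γ →
         Δ ⊢s var x · N ·* Ns ∶ B
  R→   : ∀ {Γ M A B} → ((zero , A) ∷ ↑ Γ) ⊢s M ∶ B → Γ ⊢s ƛ M ∶ A ⇒ B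
  L∩   : ∀ {Δ Γ x Ns A₁ A₂ B} →
         Δ ∼[ set ] ((x , A₁ ∩ A₂) ∷ Γ) →
         ((x , A₁) ∷ (x , A₂) ∷ Γ) ⊢s var x ·* Ns ∶ B →
         Δ ⊢s var x ·* Ns ∶ B
  R∩   : ∀ {Γ M A B} → Γ ⊢s M ∶ A → Γ ⊢s M ∶ B → Γ ⊢s M ∶ A ∩ B
  ωI   : ∀ {Γ M} → Γ ⊢s M ∶ ω

-- Every rule of Λ∩ω except →E, ∩E₁ and ∩E₂ is a rule of Λ∩ω^s. The ∩-eliminations
-- are admissible by pushing them up to the axioms. →E is admissible by cut
-- elimination: applying a derivation of A ⇒ B to one of A is proved by induction on
-- the first derivation, simultaneously with the substitution of derivations for
-- variables, under an outer induction on the size of A ⇒ B. Against R→ the cut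
-- becomes a Beta step that substitutes at the smaller type A; substituting a term
-- for the head variable of an L→ cuts at the smaller type of that variable.

module Submission where

open import Defs
open import Data.Empty using (⊥-elim)
open import Data.Nat using (ℕ; zero; suc; _<_; _≤_; _⊔_; _∸_; _+_; s≤s⁻¹; _≟_)
open import Data.Nat.Properties using (m≤m⊔n; m≤n⊔m; m≤m+n; m≤n+m; n≤1+n; ≤-refl; ≤-trans; <-≤-trans; <-irrefl)
open import Data.Product using (∃; _×_; _,_; proj₁; map₁)
open import Data.Sum using (_⊎_; inj₁; inj₂)
open import Data.List using (List; []; _∷_; map; _∷ʳ_)
open import Data.List.Properties using (foldl-∷ʳ; map-cong-local)
open import Data.List.Relation.Unary.All using (All; []; _∷_) renaming (map to All-map)
open import Data.List.Relation.Unary.Any using (here; there)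
open import Data.List.Membership.Propositional using (_∈_; _∉_)
open import Data.List.Membership.Propositional.Properties using (∈-map⁺; ∈-map⁻)
open import Data.List.Relation.Binary.Subset.Propositional using (_⊆_)
open import Data.List.Relation.Binary.BagAndSetEquality using (_∼[_]_; set)
open import Function.Bundles using (mk⇔; Equivalence)
open import Relation.Nullary using (¬_; yes; no)
open import Relation.Binary.PropositionalEquality
  using (_≡_; _≢_; refl; sym; trans; cong; cong₂; module ≡-Reasoning)
  renaming (subst to ≡-subst)

-- Syntactic renaming and substitution

·*-hom : (h : Term → Term) → (∀ M N → h (M · N) ≡ h M · h N) →
         ∀ M Ns → h (M ·* Ns) ≡ h M ·* map h Ns
·*-hom h h-· M []       = refl
·*-hom h h-· M (N ∷ Ns) = trans (·*-hom h h-· (M · N) Ns) (cong (_·* map h Ns) (h-· M N))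

rename-·* : ∀ ρ M Ns → rename ρ (M ·* Ns) ≡ rename ρ M ·* map (rename ρ) Ns
rename-·* ρ = ·*-hom (rename ρ) (λ _ _ → refl)

subst-·* : ∀ σ M Ns → subst σ (M ·* Ns) ≡ subst σ M ·* map (subst σ) Ns
subst-·* σ = ·*-hom (subst σ) (λ _ _ → refl)

rename-·*-∷ʳ : ∀ ρ M Ns N → rename ρ (M ·* Ns) · N ≡ rename ρ M ·* (map (rename ρ) Ns ∷ʳ N)
rename-·*-∷ʳ ρ M Ns N =
  trans (cong (_· N) (rename-·* ρ M Ns)) (sym (foldl-∷ʳ _·_ (rename ρ M) N (map (rename ρ) Ns)))

rename-agree : ∀ {ρ ρ'} M → (∀ x → x FreeIn M → ρ x ≡ ρ' x) → rename ρ M ≡ rename ρ' M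
rename-agree (var x) e = cong var (e x fv-var)
rename-agree (M · N) e =
  cong₂ _·_ (rename-agree M (λ x p → e x (fv-·ˡ p))) (rename-agree N (λ x p → e x (fv-·ʳ p)))
rename-agree {ρ} {ρ'} (ƛ M) e = cong ƛ_ (rename-agree M e-ext)
  where
  e-ext : ∀ x → x FreeIn M → ext ρ x ≡ ext ρ' x
  e-ext zero    _ = refl
  e-ext (suc x) p = cong suc (e x (fv-ƛ p))

subst-agree : ∀ {σ σ'} M → (∀ x → x FreeIn M → σ x ≡ σ' x) → subst σ M ≡ subst σ' M
subst-agree (var x) e = e x fv-var
subst-agree (M · N) e =
  cong₂ _·_ (subst-agree M (λ x p → e x (fv-·ˡ p))) (subst-agree N (λ x p → e x (fv-·ʳ p)))
subst-agree {σ} {σ'} (ƛ M) e = cong ƛ_ (subst-agree M e-exts)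
  where
  e-exts : ∀ x → x FreeIn M → exts σ x ≡ exts σ' x
  e-exts zero    _ = refl
  e-exts (suc x) p = cong (rename suc) (e x (fv-ƛ p))

rename-cong : ∀ {ρ ρ'} → (∀ x → ρ x ≡ ρ' x) → ∀ M → rename ρ M ≡ rename ρ' M
rename-cong e M = rename-agree M (λ x _ → e x)

subst-cong : ∀ {σ σ'} → (∀ x → σ x ≡ σ' x) → ∀ M → subst σ M ≡ subst σ' M
subst-cong e M = subst-agree M (λ x _ → e x)

rename-id : ∀ M → rename (λ x → x) M ≡ M
rename-id (var x) = refl
rename-id (M · N) = cong₂ _·_ (rename-id M) (rename-id N)
rename-id (ƛ M)   = cong ƛ_ (trans (rename-cong ext-id M) (rename-id M))
  where
  ext-id : ∀ x → ext (λ x → x) x ≡ x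
  ext-id zero    = refl
  ext-id (suc x) = refl

subst-id : ∀ M → subst var M ≡ M
subst-id (var x) = refl
subst-id (M · N) = cong₂ _·_ (subst-id M) (subst-id N)
subst-id (ƛ M)   = cong ƛ_ (trans (subst-cong exts-var M) (subst-id M))
  where
  exts-var : ∀ x → exts var x ≡ var x
  exts-var zero    = refl
  exts-var (suc x) = refl

rename-rename : ∀ ρ₁ ρ₂ M → rename ρ₂ (rename ρ₁ M) ≡ rename (λ x → ρ₂ (ρ₁ x)) M
rename-rename ρ₁ ρ₂ (var x) = refl
rename-rename ρ₁ ρ₂ (M · N) = cong₂ _·_ (rename-rename ρ₁ ρ₂ M) (rename-rename ρ₁ ρ₂ N)
rename-rename ρ₁ ρ₂ (ƛ M)   =
  cong ƛ_ (trans (rename-rename (ext ρ₁) (ext ρ₂) M) (rename-cong ext-∘ M))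
  where
  ext-∘ : ∀ x → ext ρ₂ (ext ρ₁ x) ≡ ext (λ x → ρ₂ (ρ₁ x)) x
  ext-∘ zero    = refl
  ext-∘ (suc x) = refl

subst-rename : ∀ ρ τ M → subst τ (rename ρ M) ≡ subst (λ x → τ (ρ x)) M
subst-rename ρ τ (var x) = refl
subst-rename ρ τ (M · N) = cong₂ _·_ (subst-rename ρ τ M) (subst-rename ρ τ N)
subst-rename ρ τ (ƛ M)   =
  cong ƛ_ (trans (subst-rename (ext ρ) (exts τ) M) (subst-cong exts-ext M))
  where
  exts-ext : ∀ x → exts τ (ext ρ x) ≡ exts (λ x → τ (ρ x)) x
  exts-ext zero    = refl
  exts-ext (suc x) = refl

rename-subst : ∀ σ ρ M → rename ρ (subst σ M) ≡ subst (λ x → rename ρ (σ x)) M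
rename-subst σ ρ (var x) = refl
rename-subst σ ρ (M · N) = cong₂ _·_ (rename-subst σ ρ M) (rename-subst σ ρ N)
rename-subst σ ρ (ƛ M)   =
  cong ƛ_ (trans (rename-subst (exts σ) (ext ρ) M) (subst-cong ext-exts M))
  where
  ext-exts : ∀ x → rename (ext ρ) (exts σ x) ≡ exts (λ x → rename ρ (σ x)) x
  ext-exts zero    = refl
  ext-exts (suc x) = trans (rename-rename suc (ext ρ) (σ x)) (sym (rename-rename ρ suc (σ x)))

subst-subst : ∀ σ τ M → subst τ (subst σ M) ≡ subst (λ x → subst τ (σ x)) M
subst-subst σ τ (var x) = refl
subst-subst σ τ (M · N) = cong₂ _·_ (subst-subst σ τ M) (subst-subst σ τ N)
subst-subst σ τ (ƛ M)   =
  cong ƛ_ (trans (subst-subst (exts σ) (exts τ) M) (subst-cong exts-exts M))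
  where
  exts-exts : ∀ x → subst (exts τ) (exts σ x) ≡ exts (λ x → subst τ (σ x)) x
  exts-exts zero    = refl
  exts-exts (suc x) = trans (subst-rename suc (exts τ) (σ x)) (sym (rename-subst τ suc (σ x)))

rename-[]₀ : ∀ ρ M N → rename ρ (M [ N ]₀) ≡ rename (ext ρ) M [ rename ρ N ]₀
rename-[]₀ ρ M N = begin
  rename ρ (M [ N ]₀)                           ≡⟨ rename-subst (single N) ρ M ⟩
  subst (λ x → rename ρ (single N x)) M         ≡⟨ subst-cong single-ext M ⟩
  subst (λ x → single (rename ρ N) (ext ρ x)) M ≡⟨ subst-rename (ext ρ) (single (rename ρ N)) M ⟨
  rename (ext ρ) M [ rename ρ N ]₀              ∎
  where
  open ≡-Reasoning
  single-ext : ∀ x → rename ρ (single N x) ≡ single (rename ρ N) (ext ρ x)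
  single-ext zero    = refl
  single-ext (suc x) = refl

subst-[]₀ : ∀ σ M N → subst σ (M [ N ]₀) ≡ subst (exts σ) M [ subst σ N ]₀
subst-[]₀ σ M N = begin
  subst σ (M [ N ]₀)                                    ≡⟨ subst-subst (single N) σ M ⟩
  subst (λ x → subst σ (single N x)) M                  ≡⟨ subst-cong single-exts M ⟩
  subst (λ x → subst (single (subst σ N)) (exts σ x)) M ≡⟨ subst-subst (exts σ) (single (subst σ N)) M ⟨
  subst (exts σ) M [ subst σ N ]₀                       ∎
  where
  open ≡-Reasoning
  single-exts : ∀ x → subst σ (single N x) ≡ subst (single (subst σ N)) (exts σ x)
  single-exts zero    = refl
  single-exts (suc x) =
    sym (trans (subst-rename suc (single (subst σ N)) (σ x)) (subst-id (σ x)))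

rename-β-spine : ∀ ρ M N Ns →
  rename ρ (M [ N ]₀ ·* Ns) ≡ rename (ext ρ) M [ rename ρ N ]₀ ·* map (rename ρ) Ns
rename-β-spine ρ M N Ns =
  trans (rename-·* ρ (M [ N ]₀) Ns) (cong (_·* map (rename ρ) Ns) (rename-[]₀ ρ M N))

subst-β-spine : ∀ σ M N Ns →
  subst σ (M [ N ]₀ ·* Ns) ≡ subst (exts σ) M [ subst σ N ]₀ ·* map (subst σ) Ns
subst-β-spine σ M N Ns =
  trans (subst-·* σ (M [ N ]₀) Ns) (cong (_·* map (subst σ) Ns) (subst-[]₀ σ M N))

update : {X : Set} → (ℕ → X) → ℕ → X → ℕ → X
update f y t z with z ≟ y
... | yes _ = t
... | no  _ = f z

update-≡ : ∀ {X : Set} (f : ℕ → X) y t → update f y t y ≡ t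
update-≡ f y t with y ≟ y
... | yes _  = refl
... | no y≢y = ⊥-elim (y≢y refl)

update-≢ : ∀ {X : Set} (f : ℕ → X) {y} t {z} → z ≢ y → update f y t z ≡ f z
update-≢ f {y} t {z} z≢y with z ≟ y
... | yes z≡y = ⊥-elim (z≢y z≡y)
... | no  _   = refl

Fresh : ℕ → List Term → Set
Fresh y Ns = All (λ P → ¬ y FreeIn P) Ns

rename-update-spine : ∀ ρ y y' Ns → Fresh y Ns →
  rename (update ρ y y') (var y ·* Ns) ≡ var y' ·* map (rename ρ) Ns
rename-update-spine ρ y y' Ns y∉Ns =
  trans (rename-·* (update ρ y y') (var y) Ns)
        (cong₂ _·*_ (cong var (update-≡ ρ y y')) (map-cong-local (All-map agree y∉Ns)))
  where
  agree : ∀ {P} → ¬ y FreeIn P → rename (update ρ y y') P ≡ rename ρ P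
  agree {P} y∉P = rename-agree P (λ x x∈P → update-≢ ρ y' (λ { refl → y∉P x∈P }))

subst-update-spine : ∀ σ y t Ns → Fresh y Ns →
  subst (update σ y t) (var y ·* Ns) ≡ t ·* map (subst σ) Ns
subst-update-spine σ y t Ns y∉Ns =
  trans (subst-·* (update σ y t) (var y) Ns)
        (cong₂ _·*_ (update-≡ σ y t) (map-cong-local (All-map agree y∉Ns)))
  where
  agree : ∀ {P} → ¬ y FreeIn P → subst (update σ y t) P ≡ subst σ P
  agree {P} y∉P = subst-agree P (λ x x∈P → update-≢ σ t (λ { refl → y∉P x∈P }))

-- Truncated subtraction is harmless here: only the free variable 0 of M is lost under ƛ.
fv-bound : Term → ℕ
fv-bound (var x) = suc x
fv-bound (M · N) = fv-bound M ⊔ fv-bound N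
fv-bound (ƛ M)   = fv-bound M ∸ 1

FreeIn⇒<fv-bound : ∀ {x} M → x FreeIn M → x < fv-bound M
FreeIn⇒<fv-bound (var x) fv-var   = ≤-refl
FreeIn⇒<fv-bound (M · N) (fv-·ˡ p) = ≤-trans (FreeIn⇒<fv-bound M p) (m≤m⊔n _ _)
FreeIn⇒<fv-bound (M · N) (fv-·ʳ p) = ≤-trans (FreeIn⇒<fv-bound N p) (m≤n⊔m _ _)
FreeIn⇒<fv-bound (ƛ M)   (fv-ƛ p)  = pred-< (fv-bound M) (FreeIn⇒<fv-bound M p)
  where
  pred-< : ∀ {x} b → suc x < b → x < b ∸ 1
  pred-< (suc b) x<b = s≤s⁻¹ x<b

fvs-bound : List Term → ℕ
fvs-bound []       = 0
fvs-bound (M ∷ Ms) = fv-bound M ⊔ fvs-bound Ms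

fvs-bound≤⇒Fresh : ∀ {y} Ns → fvs-bound Ns ≤ y → Fresh y Ns
fvs-bound≤⇒Fresh []       _  = []
fvs-bound≤⇒Fresh (P ∷ Ns) le =
  (λ y∈P → <-irrefl refl (<-≤-trans (FreeIn⇒<fv-bound P y∈P) (≤-trans (m≤m⊔n _ _) le)))
  ∷ fvs-bound≤⇒Fresh Ns (≤-trans (m≤n⊔m _ _) le)

dom-bound : Ctx → ℕ
dom-bound []            = 0
dom-bound ((z , _) ∷ Γ) = suc z ⊔ dom-bound Γ

dom-bound≤⇒∉dom : ∀ {y} Γ → dom-bound Γ ≤ y → y ∉ dom Γ
dom-bound≤⇒∉dom ((z , _) ∷ Γ) le (here refl) = <-irrefl refl (≤-trans (m≤m⊔n _ (dom-bound Γ)) le)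
dom-bound≤⇒∉dom ((z , _) ∷ Γ) le (there p)   = dom-bound≤⇒∉dom Γ (≤-trans (m≤n⊔m _ _) le) p

fresh : Ctx → List Term → ℕ
fresh Γ Ns = dom-bound Γ ⊔ fvs-bound Ns

fresh-∉dom : ∀ Γ Ns → fresh Γ Ns ∉ dom Γ
fresh-∉dom Γ Ns = dom-bound≤⇒∉dom Γ (m≤m⊔n _ _)

fresh-Fresh : ∀ Γ Ns → Fresh (fresh Γ Ns) Ns
fresh-Fresh Γ Ns = fvs-bound≤⇒Fresh Ns (m≤n⊔m _ _)

∼set-head : ∀ {Δ Γ : Ctx} {p} → Δ ∼[ set ] (p ∷ Γ) → p ∈ Δ
∼set-head eq = Equivalence.from eq (here refl)

∼set-tail : ∀ {Δ Γ : Ctx} {p} → Δ ∼[ set ] (p ∷ Γ) → Γ ⊆ Δ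
∼set-tail eq q = Equivalence.from eq (there q)

∈⇒∼set-∷ : ∀ {Γ : Ctx} {p} → p ∈ Γ → Γ ∼[ set ] (p ∷ Γ)
∈⇒∼set-∷ p∈Γ = mk⇔ there λ { (here refl) → p∈Γ ; (there q) → q }

∈-↑⁺ : ∀ {Γ z C} → (z , C) ∈ Γ → (suc z , C) ∈ ↑ Γ
∈-↑⁺ = ∈-map⁺ (map₁ suc)

∈-↑⁻ : ∀ {Γ z C} → (z , C) ∈ ↑ Γ → ∃ λ z₀ → z ≡ suc z₀ × (z₀ , C) ∈ Γ
∈-↑⁻ p with ∈-map⁻ (map₁ suc) p
... | (z₀ , _) , q , refl = z₀ , refl , q

∉dom⇒≢ : ∀ {Γ y z C} → y ∉ dom Γ → (z , C) ∈ Γ → z ≢ y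
∉dom⇒≢ y∉Γ p refl = y∉Γ (∈-map⁺ proj₁ p)

-- Admissible rules of Λ∩ω^s

cast : ∀ {Γ M M' A} → M ≡ M' → Γ ⊢s M ∶ A → Γ ⊢s M' ∶ A
cast refl d = d

Renaming : (ℕ → ℕ) → Ctx → Ctx → Set
Renaming ρ Γ Γ' = ∀ {z C} → (z , C) ∈ Γ → (ρ z , C) ∈ Γ'

Renaming-∷ : ∀ {ρ Γ Γ' x A} → (ρ x , A) ∈ Γ' → Renaming ρ Γ Γ' → Renaming ρ ((x , A) ∷ Γ) Γ'
Renaming-∷ q ok (here refl) = q
Renaming-∷ q ok (there p)   = ok p

Renaming-update : ∀ {ρ Γ Γ' y y' A} → Renaming ρ Γ Γ' → y ∉ dom Γ → (y' , A) ∈ Γ' →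
                  Renaming (update ρ y y') ((y , A) ∷ Γ) Γ'
Renaming-update {ρ} {Γ' = Γ'} {y} {y'} ok y∉Γ q (here refl) =
  ≡-subst (λ w → (w , _) ∈ Γ') (sym (update-≡ ρ y y')) q
Renaming-update {ρ} {Γ' = Γ'} {y} {y'} ok y∉Γ q (there p) =
  ≡-subst (λ w → (w , _) ∈ Γ') (sym (update-≢ ρ y' (∉dom⇒≢ y∉Γ p))) (ok p)

Renaming-ext : ∀ {ρ Γ Γ' A} → Renaming ρ Γ Γ' → Renaming (ext ρ) ((zero , A) ∷ ↑ Γ) ((zero , A) ∷ ↑ Γ')
Renaming-ext ok (here refl) = here refl
Renaming-ext ok (there p) with ∈-↑⁻ p
... | _ , refl , q = there (∈-↑⁺ (ok q))

rename-⊢s : ∀ {Γ Γ' M A} ρ → Renaming ρ Γ Γ' → Γ ⊢s M ∶ A → Γ' ⊢s rename ρ M ∶ A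
rename-⊢s ρ ok (Ax p) = Ax (ok p)
rename-⊢s ρ ok (Beta {M = P} {N = Q} {Ns = Ns} d e) =
  cast (sym (rename-·* ρ ((ƛ P) · Q) Ns))
    (Beta {Ns = map (rename ρ) Ns} (cast (rename-β-spine ρ P Q Ns) (rename-⊢s ρ ok d))
          (rename-⊢s ρ ok e))
rename-⊢s {Γ' = Γ'} ρ ok (L→ {x = x} {y} {N} {Ns} eq ⊢N ⊢yNs y∉Ns y∉Γ) =
  cast (sym (rename-·* ρ (var x · N) Ns))
    (L→ {y = y'} {Ns = Ns'} (∈⇒∼set-∷ (ok (∼set-head eq))) (rename-⊢s ρ ok₀ ⊢N)
        (cast (rename-update-spine ρ y y' Ns y∉Ns)
              (rename-⊢s (update ρ y y') (Renaming-update (λ p → there (ok₀ p)) y∉Γ (here refl)) ⊢yNs))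
        (fresh-Fresh Γ' Ns') (fresh-∉dom Γ' Ns'))
  where
  ok₀ = λ {z} {C} p → ok {z} {C} (∼set-tail eq p)
  Ns' = map (rename ρ) Ns
  y'  = fresh Γ' Ns'
rename-⊢s ρ ok (R→ d) = R→ (rename-⊢s (ext ρ) (Renaming-ext ok) d)
rename-⊢s ρ ok (L∩ {x = x} {Ns} eq d) =
  cast (sym (rename-·* ρ (var x) Ns))
    (L∩ {Ns = map (rename ρ) Ns} (∈⇒∼set-∷ (ok (∼set-head eq)))
        (cast (rename-·* ρ (var x) Ns)
              (rename-⊢s ρ (Renaming-∷ (here refl) (Renaming-∷ (there (here refl))
                              (λ p → there (there (ok (∼set-tail eq p)))))) d)))
rename-⊢s ρ ok (R∩ d e) = R∩ (rename-⊢s ρ ok d) (rename-⊢s ρ ok e)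
rename-⊢s ρ ok ωI = ωI

weaken : ∀ {Γ Γ' M A} → Γ ⊆ Γ' → Γ ⊢s M ∶ A → Γ' ⊢s M ∶ A
weaken {M = M} Γ⊆Γ' d = cast (rename-id M) (rename-⊢s (λ x → x) Γ⊆Γ' d)

-- The elimination rules of ∩ are pushed up to the axioms, where L∩ splits the variable.

∩E₁-admissible : ∀ {Γ M A B} → Γ ⊢s M ∶ A ∩ B → Γ ⊢s M ∶ A
∩E₁-admissible (Ax p)                       = L∩ {Ns = []} (∈⇒∼set-∷ p) (Ax (here refl))
∩E₁-admissible (Beta {M = M} {Ns = Ns} d e) = Beta {M = M} {Ns = Ns} (∩E₁-admissible d) e
∩E₁-admissible (L→ {y = y} {Ns = Ns} eq ⊢N d y∉Ns y∉Γ) =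
  L→ {y = y} {Ns = Ns} eq ⊢N (∩E₁-admissible d) y∉Ns y∉Γ
∩E₁-admissible (L∩ {Ns = Ns} eq d)          = L∩ {Ns = Ns} eq (∩E₁-admissible d)
∩E₁-admissible (R∩ d e)                     = d

∩E₂-admissible : ∀ {Γ M A B} → Γ ⊢s M ∶ A ∩ B → Γ ⊢s M ∶ B
∩E₂-admissible (Ax p)                       = L∩ {Ns = []} (∈⇒∼set-∷ p) (Ax (there (here refl)))
∩E₂-admissible (Beta {M = M} {Ns = Ns} d e) = Beta {M = M} {Ns = Ns} (∩E₂-admissible d) e
∩E₂-admissible (L→ {y = y} {Ns = Ns} eq ⊢N d y∉Ns y∉Γ) =
  L→ {y = y} {Ns = Ns} eq ⊢N (∩E₂-admissible d) y∉Ns y∉Γ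
∩E₂-admissible (L∩ {Ns = Ns} eq d)          = L∩ {Ns = Ns} eq (∩E₂-admissible d)
∩E₂-admissible (R∩ d e)                     = e

-- Cut admissibility

size : Type → ℕ
size (φ _)   = 1
size ω       = 1
size (A ⇒ B) = suc (size A + size B)
size (A ∩ B) = suc (size A + size B)

size-left≤ : ∀ {A B n} → suc (size A + size B) ≤ n → size A ≤ n
size-left≤ {A} {B} le = ≤-trans (m≤m+n (size A) (size B)) (≤-trans (n≤1+n _) le)

size-right≤ : ∀ {A B n} → suc (size A + size B) ≤ n → size B ≤ n
size-right≤ {A} {B} le = ≤-trans (m≤n+m (size B) (size A)) (≤-trans (n≤1+n _) le)

-- What a substitution may put in place of a variable of type C: a variable of
-- type C, which keeps the head of an L→ or L∩ a variable, or any term of type C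
-- provided C is small enough for the cuts this creates.
Target : ℕ → Ctx → Term → Type → Set
Target n Γ t C = (∃ λ z → t ≡ var z × (z , C) ∈ Γ) ⊎ (Γ ⊢s t ∶ C × size C ≤ n)

Target⇒⊢s : ∀ {n Γ t C} → Target n Γ t C → Γ ⊢s t ∶ C
Target⇒⊢s (inj₁ (_ , refl , p)) = Ax p
Target⇒⊢s (inj₂ (d , _))        = d

Target-weaken : ∀ {n Γ Γ' t C} → Γ ⊆ Γ' → Target n Γ t C → Target n Γ' t C
Target-weaken Γ⊆Γ' (inj₁ (z , e , p)) = inj₁ (z , e , Γ⊆Γ' p)
Target-weaken Γ⊆Γ' (inj₂ (d , le))    = inj₂ (weaken Γ⊆Γ' d , le)

Substitution : ℕ → (ℕ → Term) → Ctx → Ctx → Set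
Substitution n σ Γ Γ' = ∀ {z C} → (z , C) ∈ Γ → Target n Γ' (σ z) C

Substitution-∷ : ∀ {n σ Γ Γ' x A} → Target n Γ' (σ x) A → Substitution n σ Γ Γ' →
                 Substitution n σ ((x , A) ∷ Γ) Γ'
Substitution-∷ t ok (here refl) = t
Substitution-∷ t ok (there p)   = ok p

Substitution-update : ∀ {n σ Γ Γ' y t A} → Substitution n σ Γ Γ' → y ∉ dom Γ → Target n Γ' t A →
                      Substitution n (update σ y t) ((y , A) ∷ Γ) Γ'
Substitution-update {n} {σ} {Γ' = Γ'} {y} {t} ok y∉Γ t-ok (here refl) =
  ≡-subst (λ u → Target n Γ' u _) (sym (update-≡ σ y t)) t-ok
Substitution-update {n} {σ} {Γ' = Γ'} {y} {t} ok y∉Γ t-ok (there p) =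
  ≡-subst (λ u → Target n Γ' u _) (sym (update-≢ σ t (∉dom⇒≢ y∉Γ p))) (ok p)

Substitution-exts : ∀ {n σ Γ Γ' A} → Substitution n σ Γ Γ' →
                    Substitution n (exts σ) ((zero , A) ∷ ↑ Γ) ((zero , A) ∷ ↑ Γ')
Substitution-exts ok (here refl) = inj₁ (zero , refl , here refl)
Substitution-exts ok (there p) with ∈-↑⁻ p
... | _ , refl , q with ok q
...   | inj₁ (z , e , r) = inj₁ (suc z , cong (rename suc) e , there (∈-↑⁺ r))
...   | inj₂ (d , le)    = inj₂ (rename-⊢s suc (λ r → there (∈-↑⁺ r)) d , le)

SubstAdmissible : ℕ → Set
SubstAdmissible n = ∀ {Γ Γ' M A} σ → Substitution n σ Γ Γ' → Γ ⊢s M ∶ A → Γ' ⊢s subst σ M ∶ A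

AppAdmissible : ℕ → Set
AppAdmissible n = ∀ {Γ Γ' M N A B} ρ → size (A ⇒ B) ≤ n → Renaming ρ Γ Γ' →
                  Γ ⊢s M ∶ A ⇒ B → Γ' ⊢s N ∶ A → Γ' ⊢s rename ρ M · N ∶ B

module SubstLemma (n : ℕ) (app-admissible : AppAdmissible n) where

  subst-⊢s : SubstAdmissible n
  subst-⊢s σ ok (Ax p) = Target⇒⊢s (ok p)
  subst-⊢s σ ok (Beta {M = P} {N = Q} {Ns = Ns} d e) =
    cast (sym (subst-·* σ ((ƛ P) · Q) Ns))
      (Beta {Ns = map (subst σ) Ns} (cast (subst-β-spine σ P Q Ns) (subst-⊢s σ ok d))
            (subst-⊢s σ ok e))
  subst-⊢s {Γ' = Γ'} σ ok (L→ {x = x} {y} {N} {Ns} {A₁} {A₂} eq ⊢N ⊢yNs y∉Ns y∉Γ)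
    with ok (∼set-head eq)
  ... | inj₁ (x' , e , q) =
    cast (trans (cong (λ h → h · subst σ N ·* Ns') (sym e)) (sym (subst-·* σ (var x · N) Ns)))
      (L→ {y = y'} {Ns = Ns'} (∈⇒∼set-∷ q) (subst-⊢s σ ok₀ ⊢N)
          (cast (subst-update-spine σ y (var y') Ns y∉Ns)
                (subst-⊢s (update σ y (var y'))
                          (Substitution-update (λ p → Target-weaken there (ok₀ p)) y∉Γ
                                               (inj₁ (y' , refl , here refl)))
                          ⊢yNs))
          (fresh-Fresh Γ' Ns') (fresh-∉dom Γ' Ns'))
    where
    ok₀ = λ {z} {C} p → ok {z} {C} (∼set-tail eq p)
    Ns' = map (subst σ) Ns
    y'  = fresh Γ' Ns'
  -- The head x is replaced by a term of type A₁ ⇒ A₂: cut it against the argument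
  -- at that smaller type, and substitute the result for y.
  ... | inj₂ (⊢σx , le) =
    cast (trans (subst-update-spine σ y σxN Ns y∉Ns) (sym (subst-·* σ (var x · N) Ns)))
      (subst-⊢s (update σ y σxN) (Substitution-update ok₀ y∉Γ (inj₂ (⊢σxN , size-right≤ {A₁} le)))
                ⊢yNs)
    where
    ok₀ = λ {z} {C} p → ok {z} {C} (∼set-tail eq p)
    σxN = σ x · subst σ N
    ⊢σxN : Γ' ⊢s σxN ∶ A₂
    ⊢σxN = cast (cong (_· subst σ N) (rename-id (σ x)))
                (app-admissible (λ z → z) le (λ p → p) ⊢σx (subst-⊢s σ ok₀ ⊢N))
  subst-⊢s σ ok (R→ d) = R→ (subst-⊢s (exts σ) (Substitution-exts ok) d)
  subst-⊢s σ ok (L∩ {x = x} {Ns} {A₁} eq d) with ok (∼set-head eq)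
  ... | inj₁ (x' , e , q) =
    cast (trans (cong (_·* map (subst σ) Ns) (sym e)) (sym (subst-·* σ (var x) Ns)))
      (L∩ {Ns = map (subst σ) Ns} (∈⇒∼set-∷ q)
          (cast (trans (subst-·* σ (var x) Ns) (cong (_·* map (subst σ) Ns) e))
                (subst-⊢s σ ok' d)))
    where
    ok' = Substitution-∷ (inj₁ (x' , e , here refl)) (Substitution-∷ (inj₁ (x' , e , there (here refl)))
            (λ p → Target-weaken (λ r → there (there r)) (ok (∼set-tail eq p))))
  ... | inj₂ (⊢σx , le) = subst-⊢s σ ok' d
    where
    ok' = Substitution-∷ (inj₂ (∩E₁-admissible ⊢σx , size-left≤ {A₁} le))
            (Substitution-∷ (inj₂ (∩E₂-admissible ⊢σx , size-right≤ {A₁} le))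
              (λ p → ok (∼set-tail eq p)))
  subst-⊢s σ ok (R∩ d e) = R∩ (subst-⊢s σ ok d) (subst-⊢s σ ok e)
  subst-⊢s σ ok ωI = ωI

module AppLemma (m : ℕ) (subst-admissible : SubstAdmissible m) where

  app-⊢s : AppAdmissible (suc m)
  app-⊢s {Γ' = Γ'} ρ le ok (Ax p) ⊢N =
    L→ {y = fresh Γ' []} {Ns = []} (∈⇒∼set-∷ (ok p)) ⊢N (Ax (here refl)) [] (fresh-∉dom Γ' [])
  app-⊢s {N = N} ρ le ok (Beta {M = P} {N = Q} {Ns = Ns} d e) ⊢N =
    cast (sym (rename-·*-∷ʳ ρ ((ƛ P) · Q) Ns N))
      (Beta {Ns = map (rename ρ) Ns ∷ʳ N}
            (cast (trans (rename-·*-∷ʳ ρ (P [ Q ]₀) Ns N)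
                         (cong (_·* (map (rename ρ) Ns ∷ʳ N)) (rename-[]₀ ρ P Q)))
                  (app-⊢s ρ le ok d ⊢N))
            (rename-⊢s ρ ok e))
  app-⊢s {Γ' = Γ'} {N = N} ρ le ok (L→ {x = x} {y} {N'} {Ns} eq ⊢N' ⊢yNs y∉Ns y∉Γ) ⊢N =
    cast (sym (rename-·*-∷ʳ ρ (var x · N') Ns N))
      (L→ {y = y'} {Ns = Ns' ∷ʳ N} (∈⇒∼set-∷ (ok (∼set-head eq))) (rename-⊢s ρ ok₀ ⊢N')
          (cast (trans (cong (_· N) (rename-update-spine ρ y y' Ns y∉Ns))
                       (sym (foldl-∷ʳ _·_ (var y') N Ns')))
                (app-⊢s (update ρ y y') le (Renaming-update (λ p → there (ok₀ p)) y∉Γ (here refl))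
                        ⊢yNs (weaken there ⊢N)))
          (fresh-Fresh Γ' (Ns' ∷ʳ N)) (fresh-∉dom Γ' (Ns' ∷ʳ N)))
    where
    ok₀ = λ {z} {C} p → ok {z} {C} (∼set-tail eq p)
    Ns' = map (rename ρ) Ns
    y'  = fresh Γ' (Ns' ∷ʳ N)
  -- The cut against R→ is a β-redex: contract it by substituting the argument,
  -- whose type A is strictly smaller than A ⇒ B.
  app-⊢s {Γ' = Γ'} {N = N} ρ le ok (R→ {M = P} {A = A} d) ⊢N =
    Beta {Ns = []} (cast (sym (subst-rename (ext ρ) (single N) P)) (subst-admissible σ ok' d)) ⊢N
    where
    σ : ℕ → Term
    σ z = single N (ext ρ z)
    ok' : Substitution m σ ((zero , A) ∷ ↑ _) Γ'
    ok' (here refl) = inj₂ (⊢N , ≤-trans (m≤m+n (size A) _) (s≤s⁻¹ le))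
    ok' (there p) with ∈-↑⁻ p
    ... | z , refl , q = inj₁ (ρ z , refl , ok q)
  app-⊢s {N = N} ρ le ok (L∩ {x = x} {Ns} eq d) ⊢N =
    cast (sym (rename-·*-∷ʳ ρ (var x) Ns N))
      (L∩ {Ns = map (rename ρ) Ns ∷ʳ N} (∈⇒∼set-∷ (ok (∼set-head eq)))
          (cast (rename-·*-∷ʳ ρ (var x) Ns N)
                (app-⊢s ρ le ok' d (weaken (λ r → there (there r)) ⊢N))))
    where
    ok' = Renaming-∷ (here refl) (Renaming-∷ (there (here refl))
            (λ p → there (there (ok (∼set-tail eq p)))))

subst-admissible : ∀ n → SubstAdmissible n
app-admissible   : ∀ n → AppAdmissible n

subst-admissible n = SubstLemma.subst-⊢s n (app-admissible n)

app-admissible zero    ρ () ok d ⊢N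
app-admissible (suc m) = AppLemma.app-⊢s m (subst-admissible m)

→E-admissible : ∀ {Γ M N A B} → Γ ⊢s M ∶ A ⇒ B → Γ ⊢s N ∶ A → Γ ⊢s M · N ∶ B
→E-admissible {M = M} {A = A} {B} d e =
  cast (cong (_· _) (rename-id M)) (app-admissible (size (A ⇒ B)) (λ x → x) ≤-refl (λ p → p) d e)

⊢ω⇒⊢s : ∀ {Γ M A} → Γ ⊢ω M ∶ A → Γ ⊢s M ∶ A
⊢ω⇒⊢s (Ax p)    = Ax p
⊢ω⇒⊢s (→I d)    = R→ (⊢ω⇒⊢s d)
⊢ω⇒⊢s (→E d e)  = →E-admissible (⊢ω⇒⊢s d) (⊢ω⇒⊢s e)
⊢ω⇒⊢s (∩I d e)  = R∩ (⊢ω⇒⊢s d) (⊢ω⇒⊢s e)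
⊢ω⇒⊢s (∩E₁ d)   = ∩E₁-admissible (⊢ω⇒⊢s d)
⊢ω⇒⊢s (∩E₂ d)   = ∩E₂-admissible (⊢ω⇒⊢s d)
⊢ω⇒⊢s ωI        = ωI

theorem6 : ∀ {Γ M A} → Valid Γ → Γ ⊢ω M ∶ A → Γ ⊢s M ∶ A
theorem6 _ = ⊢ω⇒⊢s
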